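{- For every graph $G$, $\mathrm{mw}(G)=\omega(G)$.
   Context: All graphs are finite, simple and undirected; $\omega(G)$ is the clique number. For vertices $u,v$ of a connected graph, $I(u,v)$ is the set of vertices on shortest $(u,v)$-paths; a vertex set $S$ is convex if $I(u,v)\subseteq S$ for all $u,v\in S$. A median graph is a connected graph $M$ with $|I(u,v)\cap I(v,w)\cap I(w,u)|=1$ for all vertices $u,v,w$. A median decomposition of $G$ is a pair $(M,\mathcal{X})$ with $M$ a median graph and $\mathcal{X}=(X_a)_{a\in V(M)}$ subsets of $V(G)$ such that (M1) every edge of $G$ has both ends in some $X_a$, and (M2) for every $v\in V(G)$, $X^{ -1}(v)=\{a: v\in X_a\}$ is non-empty and convex in $M$. Its width is $\max_a|X_a|$; the medianwidth $\mathrm{mw}(G)$ is the minimum width over all median decompositions of $G$. -}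

module Defs where

open import Data.Nat using (ℕ; zero; suc; _≤_; _<_; _⊔_)
open import Data.Bool using (Bool; true; false)
open import Data.Fin using (Fin)
open import Data.Fin.Subset using (Subset; _∈_; ∣_∣)
open import Data.List using (List; foldr; map; allFin)
open import Data.Product using (Σ; _×_; ∃; ∃-syntax)
open import Relation.Binary.PropositionalEquality using (_≡_; _≢_)
open import Relation.Nullary using (¬_)

record Graph : Set where
  field
    n       : ℕ
    adj     : Fin n → Fin n → Bool
    adj-sym : ∀ u v → adj u v ≡ adj v u
    adj-irr : ∀ u → adj u u ≡ false

open Graph public

V : Graph → Set
V G = Fin (n G)

Edge : (G : Graph) → V G → V G → Set
Edge G u v = adj G u v ≡ true

data Walk (G : Graph) : V G → V G → ℕ → Set where
  nil  : ∀ {u} → Walk G u u 0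
  cons : ∀ {u v w k} → Edge G u v → Walk G v w k → Walk G u w (suc k)

data OnWalk (G : Graph) (x : V G) : ∀ {u v k} → Walk G u v k → Set where
  here-nil  : OnWalk G x (nil {u = x})
  here-cons : ∀ {v w k} (e : Edge G x v) (p : Walk G v w k) → OnWalk G x (cons e p)
  there     : ∀ {u v w k} (e : Edge G u v) (p : Walk G v w k) → OnWalk G x p → OnWalk G x (cons e p)

Shortest : (G : Graph) {u v : V G} {k : ℕ} → Walk G u v k → Set
Shortest G {u} {v} {k} _ = ∀ j → Walk G u v j → k ≤ j

Interval : (G : Graph) → V G → V G → V G → Set
Interval G u v x = Σ ℕ λ k → Σ (Walk G u v k) λ p → Shortest G p × OnWalk G x p

Connected : Graph → Set
Connected G = (0 < n G) × (∀ u v → ∃[ k ] Walk G u v k)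

Convex : (G : Graph) → (V G → Set) → Set
Convex G S = ∀ u v → S u → S v → ∀ x → Interval G u v x → S x

IsMedian : Graph → Set
IsMedian M = Connected M ×
  (∀ u v w → Σ (V M) λ x →
     (Interval M u v x × Interval M v w x × Interval M w u x) ×
     (∀ y → Interval M u v y → Interval M v w y → Interval M w u y → y ≡ x))

record MedianDecomposition (G : Graph) : Set where
  field
    M        : Graph
    median   : IsMedian M
    X        : V M → Subset (n G)
    covers   : ∀ u v → Edge G u v → ∃[ a ] (u ∈ X a × v ∈ X a)
    nonempty : ∀ v → ∃[ a ] (v ∈ X a)
    convex   : ∀ v → Convex M (λ a → v ∈ X a)

open MedianDecomposition public

width : {G : Graph} → MedianDecomposition G → ℕ
width D = foldr _⊔_ 0 (map (λ a → ∣ X D a ∣) (allFin (n (M D))))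

IsMedianwidth : Graph → ℕ → Set
IsMedianwidth G k = (Σ (MedianDecomposition G) λ D → width D ≡ k)
                  × (∀ (D : MedianDecomposition G) → k ≤ width D)

IsClique : (G : Graph) → Subset (n G) → Set
IsClique G C = ∀ u v → u ∈ C → v ∈ C → u ≢ v → Edge G u v

IsCliqueNumber : Graph → ℕ → Set
IsCliqueNumber G k = (Σ (Subset (n G)) λ C → IsClique G C × ∣ C ∣ ≡ k)
                   × (∀ C → IsClique G C → ∣ C ∣ ≤ k)

-- Lower bound: in a median graph, three pairwise intersecting convex sets share a
-- point, namely the median of three pairwise witnesses; by induction, so do
-- finitely many (Helly).  The sets X⁻¹(v), for v in a clique, are convex and pairwise
-- intersecting, so every clique lies in a single bag.
--
-- Upper bound: take the hypercube whose coordinates are the ordered pairs of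
-- vertices, and put v into the bag of a word q when q(v,w) = 1 and q(w,v) = 0 for
-- every non-neighbour w of v.  Two non-adjacent vertices cannot both pass this
-- test, so every bag is a clique; X⁻¹(v) is a subcube, hence convex; and a clique K
-- lies in the bag of the word q(v,w) = [v ∈ K and w ∉ K].  The largest bag of this
-- decomposition is therefore a maximum clique, and its size is also the medianwidth.
module Submission where

open import Defs
open import Data.Nat using (ℕ; zero; suc; _+_; _*_; _^_; _≤_; _≡ᵇ_; z≤n; s≤s)
open import Data.Nat.Properties
  using ( ≤-refl; ≤-reflexive; ≤-trans; ≤-antisym; +-mono-≤; +-monoˡ-≤; +-monoʳ-≤
        ; +-cancelˡ-≤; +-cancelʳ-≤; suc-injective; 1+n≢0; m^n>0; n≤0⇒n≡0
        ; ≡ᵇ⇒≡; ≡⇒≡ᵇ; ⊔-sel; m⊔n≤o⇒m≤o; m⊔n≤o⇒n≤o; +-0-commutativeMonoid )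
  renaming (module ≤-Reasoning to ℕ≤-Reasoning)
open import Algebra.Properties.CommutativeMonoid.Sum +-0-commutativeMonoid
  using (sum; sum-cong-≗; sum-replicate-zero; ∑-distrib-+)
open import Data.Bool using (Bool; true; false)
open import Data.Bool.Properties using (T-≡)
import Data.Bool.Properties as Bool
open import Data.Fin using (Fin; zero; suc; combine; remQuot; finToFun; funToFin; fromℕ<)
open import Data.Fin.Patterns using (0F; 1F)
open import Data.Fin.Properties
  using (_≟_; all?; ∀-cons; ¬∀⟶∃¬; remQuot-combine; finToFun-funToFin; funToFin-finToFin)
open import Data.Fin.Subset using (Subset; _∈_; _∉_; _⊆_; _∪_; ⁅_⁆; ∣_∣)
open import Data.Fin.Subset.Properties
  using (_∈?_; x∈⁅x⁆; x∈⁅y⁆⇒x≡y; x∈p∪q⁻; x∈p∪q⁺; p⊆q⇒∣p∣≤∣q∣)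
open import Data.List using (map; allFin)
open import Data.List.Properties using (foldr-forcesᵇ)
open import Data.List.Relation.Unary.All as All using ()
open import Data.List.Membership.Propositional.Properties
  using (foldr-selective; ∈-map⁺; ∈-map⁻; ∈-allFin)
open import Data.Vec using (tabulate; lookup)
open import Data.Vec.Properties using (lookup∘tabulate; []=⇒lookup; lookup⇒[]=)
open import Data.Vec.Functional using (updateAt; replicate)
open import Data.Vec.Functional.Properties using (updateAt-minimal)
open import Data.Product using (Σ; ∃; _×_; _,_; proj₁; proj₂; uncurry)
open import Data.Sum using (_⊎_; inj₁; inj₂)
open import Function using (_∘_; const; Equivalence)
open import Relation.Nullary using (¬_; Dec; yes; no; does; ¬?; contradiction)
open import Relation.Nullary.Decidable using (dec-true; _→-dec_; _×-dec_)
open import Relation.Unary using (Decidable)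
open import Relation.Binary.PropositionalEquality
  using (_≡_; _≢_; _≗_; refl; sym; trans; cong; cong₂; subst; module ≡-Reasoning)

Bit : Set
Bit = Fin 2

flipBit : Bit → Bit
flipBit 0F = 1F
flipBit 1F = 0F

δ : Bit → Bit → ℕ
δ 0F 0F = 0
δ 0F 1F = 1
δ 1F 0F = 1
δ 1F 1F = 0

δ-sym : ∀ a b → δ a b ≡ δ b a
δ-sym 0F 0F = refl
δ-sym 0F 1F = refl
δ-sym 1F 0F = refl
δ-sym 1F 1F = refl

δ≡0⇒≡ : ∀ {a b} → δ a b ≡ 0 → a ≡ b
δ≡0⇒≡ {0F} {0F} _ = refl
δ≡0⇒≡ {1F} {1F} _ = refl
δ≡0⇒≡ {0F} {1F} ()
δ≡0⇒≡ {1F} {0F} ()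

≡⇒δ≡0 : ∀ {a b} → a ≡ b → δ a b ≡ 0
≡⇒δ≡0 {0F} refl = refl
≡⇒δ≡0 {1F} refl = refl

δ-flip : ∀ a → δ a (flipBit a) ≡ 1
δ-flip 0F = refl
δ-flip 1F = refl

δ-triangle : ∀ a b c → δ a c ≤ δ a b + δ b c
δ-triangle 0F 0F 0F = z≤n
δ-triangle 0F 0F 1F = s≤s z≤n
δ-triangle 0F 1F 0F = z≤n
δ-triangle 0F 1F 1F = s≤s z≤n
δ-triangle 1F 0F 0F = s≤s z≤n
δ-triangle 1F 0F 1F = z≤n
δ-triangle 1F 1F 0F = s≤s z≤n
δ-triangle 1F 1F 1F = z≤n

δ-tight⇒between : ∀ a b c → δ a b + δ b c ≡ δ a c → a ≡ c → b ≡ a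
δ-tight⇒between 0F 0F _ _  refl = refl
δ-tight⇒between 1F 1F _ _  refl = refl
δ-tight⇒between 0F 1F _ () refl
δ-tight⇒between 1F 0F _ () refl

between⇒δ-tight : ∀ a b c → (a ≡ c → b ≡ a) → δ a b + δ b c ≡ δ a c
between⇒δ-tight 0F 0F 0F _ = refl
between⇒δ-tight 0F 0F 1F _ = refl
between⇒δ-tight 0F 1F 0F b≡a = contradiction (b≡a refl) λ ()
between⇒δ-tight 0F 1F 1F _ = refl
between⇒δ-tight 1F 0F 0F _ = refl
between⇒δ-tight 1F 0F 1F b≡a = contradiction (b≡a refl) λ ()
between⇒δ-tight 1F 1F 0F _ = refl
between⇒δ-tight 1F 1F 1F _ = refl

majority : Bit → Bit → Bit → Bit
majority 0F 0F _ = 0F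
majority 1F 1F _ = 1F
majority 0F 1F c = c
majority 1F 0F c = c

majority-between : ∀ a b c →
  (a ≡ b → majority a b c ≡ a) × (b ≡ c → majority a b c ≡ b) × (c ≡ a → majority a b c ≡ c)
majority-between 0F 0F 0F = const refl , const refl , const refl
majority-between 0F 0F 1F = const refl , (λ ()) , (λ ())
majority-between 0F 1F 0F = (λ ()) , (λ ()) , const refl
majority-between 0F 1F 1F = (λ ()) , const refl , (λ ())
majority-between 1F 0F 0F = (λ ()) , const refl , (λ ())
majority-between 1F 0F 1F = (λ ()) , (λ ()) , const refl
majority-between 1F 1F 0F = const refl , (λ ()) , (λ ())
majority-between 1F 1F 1F = const refl , const refl , const refl

majority-unique : ∀ a b c y →
  (a ≡ b → y ≡ a) → (b ≡ c → y ≡ b) → (c ≡ a → y ≡ c) → y ≡ majority a b c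
majority-unique 0F 0F _  _ ab _  _  = ab refl
majority-unique 1F 1F _  _ ab _  _  = ab refl
majority-unique 0F 1F 0F _ _  _  ca = ca refl
majority-unique 0F 1F 1F _ _  bc _  = bc refl
majority-unique 1F 0F 0F _ _  bc _  = bc refl
majority-unique 1F 0F 1F _ _  _  ca = ca refl

sum-mono-≤ : ∀ {d} {f g : Fin d → ℕ} → (∀ i → f i ≤ g i) → sum f ≤ sum g
sum-mono-≤ {zero}  _   = z≤n
sum-mono-≤ {suc d} f≤g = +-mono-≤ (f≤g zero) (sum-mono-≤ (f≤g ∘ suc))

sum-tight : ∀ {d} {f g : Fin d → ℕ} → (∀ i → f i ≤ g i) → sum g ≤ sum f → f ≗ g
sum-tight {suc d} {f} f≤g Σg≤Σf zero = ≤-antisym (f≤g zero)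
  (+-cancelʳ-≤ _ _ _ (≤-trans Σg≤Σf (+-monoʳ-≤ (f zero) (sum-mono-≤ (f≤g ∘ suc)))))
sum-tight {suc d} {f} f≤g Σg≤Σf (suc i) = sum-tight (f≤g ∘ suc)
  (+-cancelˡ-≤ (f zero) _ _ (≤-trans (+-monoˡ-≤ _ (f≤g zero)) Σg≤Σf)) i

Word : ℕ → Set
Word d = Fin d → Bit

ham : ∀ {d} → Word d → Word d → ℕ
ham x y = sum λ i → δ (x i) (y i)

ham-cong : ∀ {d} {x x′ y y′ : Word d} → x ≗ x′ → y ≗ y′ → ham x y ≡ ham x′ y′
ham-cong x≗x′ y≗y′ = sum-cong-≗ λ i → cong₂ δ (x≗x′ i) (y≗y′ i)

ham-sym : ∀ {d} (x y : Word d) → ham x y ≡ ham y x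
ham-sym x y = sum-cong-≗ λ i → δ-sym (x i) (y i)

≗⇒ham≡0 : ∀ {d} {x y : Word d} → x ≗ y → ham x y ≡ 0
≗⇒ham≡0 {d} x≗y = trans (sum-cong-≗ (≡⇒δ≡0 ∘ x≗y)) (sum-replicate-zero d)

ham-self : ∀ {d} (x : Word d) → ham x x ≡ 0
ham-self x = ≗⇒ham≡0 {x = x} λ _ → refl

ham≡0⇒≗ : ∀ {d} {x y : Word d} → ham x y ≡ 0 → x ≗ y
ham≡0⇒≗ {d} h i = δ≡0⇒≡ (sym (sum-tight {f = replicate d 0} (λ _ → z≤n)
  (≤-reflexive (trans h (sym (sum-replicate-zero d)))) i))

ham-+ : ∀ {d} (x y z : Word d) → sum (λ i → δ (x i) (y i) + δ (y i) (z i)) ≡ ham x y + ham y z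
ham-+ x y z = ∑-distrib-+ (λ i → δ (x i) (y i)) (λ i → δ (y i) (z i))

ham-triangle : ∀ {d} (x y z : Word d) → ham x z ≤ ham x y + ham y z
ham-triangle x y z =
  ≤-trans (sum-mono-≤ λ i → δ-triangle (x i) (y i) (z i)) (≤-reflexive (ham-+ x y z))

Between : ∀ {d} → Word d → Word d → Word d → Set
Between x y z = ∀ i → x i ≡ z i → y i ≡ x i

between-fixes : ∀ {d} {x y z : Word d} {i c} → Between x y z → x i ≡ c → z i ≡ c → y i ≡ c
between-fixes {i = i} btw xᵢ≡c zᵢ≡c = trans (btw i (trans xᵢ≡c (sym zᵢ≡c))) xᵢ≡c

ham-tight⇒between : ∀ {d} (x y z : Word d) → ham x y + ham y z ≤ ham x z → Between x y z
ham-tight⇒between x y z tight i = δ-tight⇒between (x i) (y i) (z i) (sym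
  (sum-tight (λ j → δ-triangle (x j) (y j) (z j))
             (subst (_≤ ham x z) (sym (ham-+ x y z)) tight) i))

between⇒ham-tight : ∀ {d} {x y z : Word d} → Between x y z → ham x y + ham y z ≡ ham x z
between⇒ham-tight {x = x} {y} {z} btw = trans (sym (ham-+ x y z))
  (sum-cong-≗ λ i → between⇒δ-tight (x i) (y i) (z i) (btw i))

flipAt : ∀ {d} → Word d → Fin d → Word d
flipAt x i = updateAt x i flipBit

ham-flipAt : ∀ {d} (x : Word d) i → ham x (flipAt x i) ≡ 1
ham-flipAt x zero    = cong₂ _+_ (δ-flip (x zero)) (ham-self (x ∘ suc))
ham-flipAt x (suc i) = cong₂ _+_ (≡⇒δ≡0 {x zero} refl) (ham-flipAt (x ∘ suc) i)

flipAt-between : ∀ {d} {x z : Word d} {i} → x i ≢ z i → Between x (flipAt x i) z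
flipAt-between {x = x} {i = i} xᵢ≢zᵢ j xⱼ≡zⱼ with i ≟ j
... | yes refl = contradiction xⱼ≡zⱼ xᵢ≢zᵢ
... | no  i≢j  = updateAt-minimal j i x (i≢j ∘ sym)

differing-coordinate : ∀ {d} {x y : Word d} → ¬ x ≗ y → ∃ λ i → x i ≢ y i
differing-coordinate {d} {x} {y} = ¬∀⟶∃¬ d _ λ i → x i ≟ y i

word : ∀ d → Fin (2 ^ d) → Word d
word _ = finToFun

code : ∀ {d} → Word d → Fin (2 ^ d)
code = funToFin

word-code : ∀ {d} (x : Word d) → word d (code x) ≗ x
word-code = finToFun-funToFin

code-cong : ∀ {d} {x y : Word d} → x ≗ y → code x ≡ code y
code-cong {zero}  _   = refl
code-cong {suc d} x≗y = cong₂ combine (x≗y zero) (code-cong (x≗y ∘ suc))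

word-injective : ∀ {d} {a b : Fin (2 ^ d)} → word d a ≗ word d b → a ≡ b
word-injective {d} {a} {b} wa≗wb =
  trans (sym (funToFin-finToFin {d} {2} a))
        (trans (code-cong wa≗wb) (funToFin-finToFin {d} {2} b))

module _ {m : ℕ} where

  subsetOf : ∀ {P : Fin m → Set} → Decidable P → Subset m
  subsetOf P? = tabulate (does ∘ P?)

  ∈-subsetOf⁺ : ∀ {P : Fin m → Set} (P? : Decidable P) {x} → P x → x ∈ subsetOf P?
  ∈-subsetOf⁺ P? {x} px =
    lookup⇒[]= x _ (trans (lookup∘tabulate (does ∘ P?) x) (dec-true (P? x) px))

  ∈-subsetOf⁻ : ∀ {P : Fin m → Set} (P? : Decidable P) {x} → x ∈ subsetOf P? → P x
  ∈-subsetOf⁻ P? {x} x∈ with P? x | trans (sym (lookup∘tabulate (does ∘ P?) x)) ([]=⇒lookup x∈)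
  ... | yes px | _ = px
  ... | no _   | ()

  ∉⇒lookup≡false : ∀ {p : Subset m} {x} → x ∉ p → lookup p x ≡ false
  ∉⇒lookup≡false {p} {x} x∉p with lookup p x in eq
  ... | false = refl
  ... | true  = contradiction (lookup⇒[]= x p eq) x∉p

∈-pair : ∀ {m} {u v x : Fin m} → x ∈ ⁅ u ⁆ ∪ ⁅ v ⁆ → x ≡ u ⊎ x ≡ v
∈-pair {u = u} {v} x∈ with x∈p∪q⁻ ⁅ u ⁆ ⁅ v ⁆ x∈
... | inj₁ x∈u = inj₁ (x∈⁅y⁆⇒x≡y u x∈u)
... | inj₂ x∈v = inj₂ (x∈⁅y⁆⇒x≡y v x∈v)

edge-sym : ∀ {G : Graph} {u v} → Edge G u v → Edge G v u
edge-sym {G} {u} {v} uv = trans (adj-sym G v u) uv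

edge? : ∀ (G : Graph) u v → Dec (Edge G u v)
edge? G u v = adj G u v Bool.≟ true

pair-isClique : ∀ {G : Graph} {u v} → (u ≢ v → Edge G u v) → IsClique G (⁅ u ⁆ ∪ ⁅ v ⁆)
pair-isClique {G} uv a b a∈ b∈ a≢b with ∈-pair a∈ | ∈-pair b∈
... | inj₁ refl | inj₁ refl = contradiction refl a≢b
... | inj₁ refl | inj₂ refl = uv a≢b
... | inj₂ refl | inj₁ refl = edge-sym {G} (uv (a≢b ∘ sym))
... | inj₂ refl | inj₂ refl = contradiction refl a≢b

_++ᵂ_ : ∀ {G : Graph} {a b c k l} → Walk G a b k → Walk G b c l → Walk G a c (k + l)
nil      ++ᵂ q = q
cons e p ++ᵂ q = cons e (p ++ᵂ q)

onWalk-start : ∀ {G : Graph} {a b k} (p : Walk G a b k) → OnWalk G a p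
onWalk-start nil        = here-nil
onWalk-start (cons e p) = here-cons e p

onWalk-junction : ∀ {G : Graph} {a b c k l} (p : Walk G a b k) (q : Walk G b c l) →
                  OnWalk G b (p ++ᵂ q)
onWalk-junction nil        q = onWalk-start q
onWalk-junction (cons e p) q = there e (p ++ᵂ q) (onWalk-junction p q)

split-at : ∀ {G : Graph} {x a b k} {p : Walk G a b k} → OnWalk G x p →
           Σ ℕ λ k₁ → Σ ℕ λ k₂ → Walk G a x k₁ × Walk G x b k₂ × k₁ + k₂ ≡ k
split-at here-nil                  = 0 , 0 , nil , nil , refl
split-at (here-cons {k = k} e p)   = 0 , suc k , nil , cons e p , refl
split-at (there e p x∈p) with split-at x∈p
... | k₁ , k₂ , p₁ , p₂ , k₁+k₂≡k = suc k₁ , k₂ , cons e p₁ , p₂ , cong suc k₁+k₂≡k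

-- A lower bound on walk lengths that is attained by some walk is the graph distance.
module Geodesics (G : Graph) (dist : V G → V G → ℕ)
                 (dist≤length : ∀ {u v k} → Walk G u v k → dist u v ≤ k)
                 (geodesic : ∀ u v → Walk G u v (dist u v)) where

  interval⇒dist-tight : ∀ {u v x} → Interval G u v x → dist u x + dist x v ≤ dist u v
  interval⇒dist-tight {u} {v} {x} (k , _ , shortest , x∈p) with split-at x∈p
  ... | k₁ , k₂ , p₁ , p₂ , k₁+k₂≡k = begin
    dist u x + dist x v ≤⟨ +-mono-≤ (dist≤length p₁) (dist≤length p₂) ⟩
    k₁ + k₂             ≡⟨ k₁+k₂≡k ⟩
    k                   ≤⟨ shortest _ (geodesic u v) ⟩
    dist u v            ∎
    where open ℕ≤-Reasoning

  dist-tight⇒interval : ∀ {u v x} → dist u x + dist x v ≤ dist u v → Interval G u v x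
  dist-tight⇒interval {u} {v} {x} tight =
    _ , p ++ᵂ q , (λ _ r → ≤-trans tight (dist≤length r)) , onWalk-junction p q
    where
    p : Walk G u x (dist u x)
    p = geodesic u x
    q : Walk G x v (dist x v)
    q = geodesic x v

-- Hypercubes are median graphs

Q : ℕ → Graph
Q d = record
  { n       = 2 ^ d
  ; adj     = λ a b → ham (word d a) (word d b) ≡ᵇ 1
  ; adj-sym = λ a b → cong (_≡ᵇ 1) (ham-sym (word d a) (word d b))
  ; adj-irr = λ a → cong (_≡ᵇ 1) (ham-self (word d a))
  }

module _ (d : ℕ) where

  Q-edge⇒ham≡1 : ∀ {a b} → Edge (Q d) a b → ham (word d a) (word d b) ≡ 1
  Q-edge⇒ham≡1 e = ≡ᵇ⇒≡ _ 1 (Equivalence.from T-≡ e)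

  ham≡1⇒Q-edge : ∀ {a b} → ham (word d a) (word d b) ≡ 1 → Edge (Q d) a b
  ham≡1⇒Q-edge h = Equivalence.to T-≡ (≡⇒≡ᵇ _ 1 h)

  ham≤length : ∀ {a b k} → Walk (Q d) a b k → ham (word d a) (word d b) ≤ k
  ham≤length {a} nil = ≤-reflexive (ham-self (word d a))
  ham≤length {a} {b} (cons {v = v} {k = k} e p) = begin
    ham (word d a) (word d b)                     ≤⟨ ham-triangle _ (word d v) _ ⟩
    ham (word d a) (word d v) + ham (word d v) (word d b) ≡⟨ cong (_+ _) (Q-edge⇒ham≡1 e) ⟩
    suc (ham (word d v) (word d b))               ≤⟨ s≤s (ham≤length p) ⟩
    suc k                                         ∎
    where open ℕ≤-Reasoning

  -- Flip a coordinate on which the current word differs from the target.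
  walk-of-length-ham : ∀ k a b → ham (word d a) (word d b) ≡ k → Walk (Q d) a b k
  walk-of-length-ham zero a b h =
    subst (λ c → Walk (Q d) a c 0) (word-injective {d} (ham≡0⇒≗ h)) nil
  walk-of-length-ham (suc k) a b h
    with differing-coordinate (λ a≗b → 1+n≢0 (trans (sym h) (≗⇒ham≡0 a≗b)))
  ... | i , aᵢ≢bᵢ = cons (ham≡1⇒Q-edge step) (walk-of-length-ham k (code y) b rest)
    where
    y : Word d
    y = flipAt (word d a) i

    step : ham (word d a) (word d (code y)) ≡ 1
    step = trans (ham-cong (λ _ → refl) (word-code y)) (ham-flipAt (word d a) i)

    rest : ham (word d (code y)) (word d b) ≡ k
    rest = suc-injective (begin
      suc (ham (word d (code y)) (word d b)) ≡⟨ cong suc (ham-cong (word-code y) λ _ → refl) ⟩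
      suc (ham y (word d b))                 ≡⟨ cong (_+ ham y (word d b))
                                                     (sym (ham-flipAt (word d a) i)) ⟩
      ham (word d a) y + ham y (word d b)    ≡⟨ between⇒ham-tight {x = word d a} {z = word d b}
                                                                  (flipAt-between aᵢ≢bᵢ) ⟩
      ham (word d a) (word d b)              ≡⟨ h ⟩
      suc k                                  ∎)
      where open ≡-Reasoning

  Q-geodesic : ∀ a b → Walk (Q d) a b (ham (word d a) (word d b))
  Q-geodesic a b = walk-of-length-ham _ a b refl

  open Geodesics (Q d) (λ a b → ham (word d a) (word d b)) ham≤length Q-geodesic

  Q-interval⇒between : ∀ {a b x} →
                       Interval (Q d) a b x → Between (word d a) (word d x) (word d b)
  Q-interval⇒between = ham-tight⇒between _ _ _ ∘ interval⇒dist-tight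

  between⇒Q-interval : ∀ {a b x} →
                       Between (word d a) (word d x) (word d b) → Interval (Q d) a b x
  between⇒Q-interval = dist-tight⇒interval ∘ ≤-reflexive ∘ between⇒ham-tight

  Q-isMedian : IsMedian (Q d)
  Q-isMedian = (m^n>0 2 d , λ a b → _ , Q-geodesic a b) , λ a b c →
    let m = λ i → majority (word d a i) (word d b i) (word d c i)
        atMedian : ∀ i {y} → m i ≡ y → word d (code m) i ≡ y
        atMedian i = trans (word-code m i)
    in code m
       , ( between⇒Q-interval (λ i → atMedian i ∘ proj₁ (majority-between _ _ _))
         , between⇒Q-interval (λ i → atMedian i ∘ proj₁ (proj₂ (majority-between _ _ _)))
         , between⇒Q-interval (λ i → atMedian i ∘ proj₂ (proj₂ (majority-between _ _ _))) )
       , λ y ab bc ca → word-injective {d} λ i → trans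
           (majority-unique _ _ _ _ (Q-interval⇒between ab i)
                                    (Q-interval⇒between bc i)
                                    (Q-interval⇒between ca i))
           (sym (word-code m i))

-- The Helly property of median graphs

Meets : ∀ {A : Set} → (A → Set) → (A → Set) → Set
Meets P R = ∃ λ a → P a × R a

module _ {M : Graph} where

  convex-∩ : ∀ {S T : V M → Set} → Convex M S → Convex M T → Convex M (λ a → S a × T a)
  convex-∩ cS cT u v (Su , Tu) (Sv , Tv) x x∈I = cS u v Su Sv x x∈I , cT u v Tu Tv x x∈I

  convex-⇒ : ∀ {P : Set} {S : V M → Set} → Convex M S → Convex M (λ a → P → S a)
  convex-⇒ cS u v Su Sv x x∈I p = cS u v (Su p) (Sv p) x x∈I

  median-vertex : IsMedian M → V M
  median-vertex ((0<n , _) , _) = fromℕ< 0<n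

  module _ (isMedian : IsMedian M) where

    helly-triple : ∀ {A B C : V M → Set} → Convex M A → Convex M B → Convex M C →
                   Meets A B → Meets B C → Meets C A → ∃ λ x → A x × B x × C x
    helly-triple cA cB cC (p , Ap , Bp) (q , Bq , Cq) (r , Cr , Ar)
      with proj₂ isMedian p q r
    ... | x , (x∈Ipq , x∈Iqr , x∈Irp) , _ =
      x , cA r p Ar Ap x x∈Irp , cB p q Bp Bq x x∈Ipq , cC q r Cq Cr x x∈Iqr

    helly : ∀ m (S : Fin m → V M → Set) → (∀ i → Convex M (S i)) →
            (∀ i j → Meets (S i) (S j)) → ∃ λ x → ∀ i → S i x
    helly zero          S _  _    = median-vertex isMedian , λ ()
    helly (suc zero)    S _  meet = let x , S₀x , _ = meet 0F 0F in x , λ { 0F → S₀x }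
    helly (suc (suc m)) S cS meet =
      let x , S′x = helly (suc m) S′ (λ i → convex-∩ (cS 0F) (cS (suc i))) meet′
      in x , ∀-cons (proj₁ (S′x 0F)) (proj₂ ∘ S′x)
      where
      S′ : Fin (suc m) → V M → Set
      S′ i x = S 0F x × S (suc i) x

      meet′ : ∀ i j → Meets (S′ i) (S′ j)
      meet′ i j =
        let x , S₀x , Sᵢx , Sⱼx = helly-triple (cS 0F) (cS (suc i)) (cS (suc j))
              (meet 0F (suc i)) (meet (suc i) (suc j)) (meet (suc j) 0F)
        in x , (S₀x , Sᵢx) , (S₀x , Sⱼx)

-- Median decompositions: cliques lie in bags

module _ {G : Graph} (D : MedianDecomposition G) where

  bag≤width : ∀ a → ∣ X D a ∣ ≤ width D
  bag≤width a = All.lookup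
    (foldr-forcesᵇ (λ m k m⊔k≤w → m⊔n≤o⇒m≤o m k m⊔k≤w , m⊔n≤o⇒n≤o m k m⊔k≤w) 0 _ ≤-refl)
    (∈-map⁺ (λ a → ∣ X D a ∣) (∈-allFin a))

  width-attained : ∃ λ a → ∣ X D a ∣ ≡ width D
  width-attained with foldr-selective ⊔-sel 0 (map (λ a → ∣ X D a ∣) (allFin _))
  ... | inj₁ width≡0 = let a = median-vertex (median D) in
    a , trans (n≤0⇒n≡0 (subst (∣ X D a ∣ ≤_) width≡0 (bag≤width a))) (sym width≡0)
  ... | inj₂ width∈bags = let a , _ , width≡∣a∣ = ∈-map⁻ _ width∈bags in a , sym width≡∣a∣

  clique-pairs-meet : ∀ {C} → IsClique G C → ∀ v w →
    Meets (λ a → v ∈ C → v ∈ X D a) (λ a → w ∈ C → w ∈ X D a)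
  clique-pairs-meet {C} clq v w with v ≟ w | v ∈? C | w ∈? C
  ... | yes refl | _ | _ = let a , v∈a = nonempty D v in a , const v∈a , const v∈a
  ... | no v≢w | yes v∈C | yes w∈C =
    let a , v∈a , w∈a = covers D v w (clq v w v∈C w∈C v≢w) in a , const v∈a , const w∈a
  ... | no _ | no v∉C | _ =
    let a , w∈a = nonempty D w in a , (λ v∈C → contradiction v∈C v∉C) , const w∈a
  ... | no _ | yes _ | no w∉C =
    let a , v∈a = nonempty D v in a , const v∈a , (λ w∈C → contradiction w∈C w∉C)

  clique⊆bag : ∀ {C} → IsClique G C → ∃ λ a → C ⊆ X D a
  clique⊆bag {C} clq =
    let a , C⊆a = helly (median D) (n G) (λ v a → v ∈ C → v ∈ X D a)
                        (λ v → convex-⇒ (convex D v)) (clique-pairs-meet clq)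
    in a , λ {v} v∈C → C⊆a v v∈C

  ∣clique∣≤width : ∀ {C} → IsClique G C → ∣ C ∣ ≤ width D
  ∣clique∣≤width clq =
    let a , C⊆a = clique⊆bag clq in ≤-trans (p⊆q⇒∣p∣≤∣q∣ C⊆a) (bag≤width a)

-- A median decomposition whose bags are cliques

module CliqueDecomposition (G : Graph) where

  Pairs : ℕ
  Pairs = n G * n G

  _⟨_,_⟩ : Word Pairs → V G → V G → Bit
  q ⟨ v , w ⟩ = q (combine v w)

  Favoured : Word Pairs → V G → Set
  Favoured q v = ∀ w → ¬ Edge G v w → v ≢ w → q ⟨ v , w ⟩ ≡ 1F × q ⟨ w , v ⟩ ≡ 0F

  favoured? : ∀ q → Decidable (Favoured q)
  favoured? q v = all? λ w → ¬? (edge? G v w) →-dec (¬? (v ≟ w) →-dec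
                               (q ⟨ v , w ⟩ ≟ 1F ×-dec q ⟨ w , v ⟩ ≟ 0F))

  bag : Fin (2 ^ Pairs) → Subset (n G)
  bag a = subsetOf (favoured? (word Pairs a))

  bag-isClique : ∀ a → IsClique G (bag a)
  bag-isClique a u v u∈ v∈ u≢v with edge? G u v
  ... | yes uv = uv
  ... | no ¬uv = contradiction
    (trans (sym (proj₁ (∈-subsetOf⁻ (favoured? q) u∈ v ¬uv u≢v)))
                (proj₂ (∈-subsetOf⁻ (favoured? q) v∈ u (¬uv ∘ edge-sym {G}) (u≢v ∘ sym))))
    λ ()
    where
    q : Word Pairs
    q = word Pairs a

  bag-convex : ∀ v → Convex (Q Pairs) (λ a → v ∈ bag a)
  bag-convex v a b v∈a v∈b x x∈I = ∈-subsetOf⁺ (favoured? (word Pairs x)) λ w ¬vw v≢w →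
    let btw     = Q-interval⇒between Pairs x∈I
        a₁ , a₀ = ∈-subsetOf⁻ (favoured? (word Pairs a)) v∈a w ¬vw v≢w
        b₁ , b₀ = ∈-subsetOf⁻ (favoured? (word Pairs b)) v∈b w ¬vw v≢w
    in between-fixes btw a₁ b₁ , between-fixes btw a₀ b₀

  leaving : Bool → Bool → Bit
  leaving true false = 1F
  leaving _    _     = 0F

  favouring : Subset (n G) → Word Pairs
  favouring K = uncurry (λ v w → leaving (lookup K v) (lookup K w)) ∘ remQuot (n G)

  favouring-⟨⟩ : ∀ K v w → favouring K ⟨ v , w ⟩ ≡ leaving (lookup K v) (lookup K w)
  favouring-⟨⟩ K v w =
    cong (uncurry λ v w → leaving (lookup K v) (lookup K w)) (remQuot-combine v w)

  clique⊆bag-favouring : ∀ {K} → IsClique G K → K ⊆ bag (code (favouring K))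
  clique⊆bag-favouring {K} clq {v} v∈K = ∈-subsetOf⁺ (favoured? q) λ w ¬vw v≢w →
    let w∉K : w ∉ K
        w∉K w∈K = ¬vw (clq v w v∈K w∈K v≢w)
    in trans (at v w) (cong₂ leaving ([]=⇒lookup v∈K) (∉⇒lookup≡false w∉K)) ,
       trans (at w v) (cong₂ leaving (∉⇒lookup≡false w∉K) ([]=⇒lookup v∈K))
    where
    q : Word Pairs
    q = word Pairs (code (favouring K))

    at : ∀ x y → q ⟨ x , y ⟩ ≡ leaving (lookup K x) (lookup K y)
    at x y = trans (word-code (favouring K) _) (favouring-⟨⟩ K x y)

  pair⊆bag : ∀ {u v} → (u ≢ v → Edge G u v) → ∃ λ a → u ∈ bag a × v ∈ bag a
  pair⊆bag {u} {v} uv = code (favouring (⁅ u ⁆ ∪ ⁅ v ⁆))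
    , clique⊆bag-favouring (pair-isClique {G} uv) (x∈p∪q⁺ (inj₁ (x∈⁅x⁆ u)))
    , clique⊆bag-favouring (pair-isClique {G} uv) (x∈p∪q⁺ (inj₂ (x∈⁅x⁆ v)))

  cliqueDecomposition : MedianDecomposition G
  cliqueDecomposition = record
    { M        = Q Pairs
    ; median   = Q-isMedian Pairs
    ; X        = bag
    ; covers   = λ u v uv → pair⊆bag {u} {v} (const uv)
    ; nonempty = λ v → let a , v∈a , _ = pair⊆bag {v} {v} (λ v≢v → contradiction refl v≢v)
                       in a , v∈a
    ; convex   = bag-convex
    }

theorem3p6 : (G : Graph) → Σ ℕ λ k → IsCliqueNumber G k × IsMedianwidth G k
theorem3p6 G =
  let a , ∣a∣≡width = width-attained D₀
  in width D₀
     , ((bag a , bag-isClique a , ∣a∣≡width) , λ C → ∣clique∣≤width D₀ {C})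
     , (D₀ , refl)
     , λ D → subst (_≤ width D) ∣a∣≡width (∣clique∣≤width D (bag-isClique a))
  where
  open CliqueDecomposition G
  D₀ : MedianDecomposition G
  D₀ = cliqueDecomposition
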